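{- Let $p\ge 5$ be a prime and let $a$ and $n$ be positive integers such that $\gcd(a,p)=1$. Let $k$ be an odd integer with $1\le k\le ap^n-1$. Then: if $v_p(s(ap^n,ap^n-k+1))\le 2n-1$, then $v_p(s(ap^n,ap^n-k))=v_p(s(ap^n,ap^n-k+1))+v_p(ap^n-k)+n$; and if $v_p(s(ap^n,ap^n-k+1))\ge 2n$, then $v_p(s(ap^n,ap^n-k))\ge v_p(ap^n-k)+3n$.
   Context: For nonnegative integers $n,k$, the (unsigned) Stirling numbers of the first kind $s(n,k)$ are defined by $x(x+1)\cdots(x+n-1)=\sum_{k=0}^n s(n,k)x^k$. $v_p$ denotes the $p$-adic valuation (with $v_p(0)=+\infty$). -}

module Defs where

open import Data.Nat using (ℕ; zero; suc; _+_; _*_; _^_)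
open import Data.Nat.Divisibility using (_∣_)
open import Data.Product using (_×_)
open import Relation.Nullary using (¬_)

-- Unsigned Stirling numbers of the first kind s(n,k), defined by
-- x(x+1)...(x+n-1) = Σ_k s(n,k) x^k.  Multiplying by (x+n) gives the
-- recurrence s(n+1,k+1) = n*s(n,k+1) + s(n,k), s(n+1,0) = 0, s(0,0) = 1,
-- s(0,k+1) = 0.
stirling1 : ℕ → ℕ → ℕ
stirling1 zero    zero    = 1
stirling1 zero    (suc k) = 0
stirling1 (suc n) zero    = 0
stirling1 (suc n) (suc k) = n * stirling1 n (suc k) + stirling1 n k

-- ValP p m e : the p-adic valuation of m is exactly e
-- (p^e divides m and p^(e+1) does not).  For m = 0 no e satisfies this,
-- matching v_p(0) = +∞.
ValP : ℕ → ℕ → ℕ → Set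
ValP p m e = (p ^ e ∣ m) × ¬ (p ^ suc e ∣ m)

module Submission where

-- s(N, N-j) is the elementary symmetric polynomial e_j(1, …, N-1), and the list 1, …, N-1
-- is mapped onto itself by x ↦ N - x.  The reflection formula
--   e_k(c - x₁, …, c - xₙ) = ∑_{j ≤ k} (-1)^j C(n-j, k-j) c^(k-j) e_j(x₁, …, xₙ)
-- with c = N therefore gives, for odd k, an identity
--   2·s(N, N-k) = ∑_{j < k} (-1)^j C(N-1-j, k-j) N^(k-j) s(N, N-j).
-- Its term j = k-1 is (N-k)·N·s(N, N-k+1), of valuation v_p(N-k) + n + v_p(s(N, N-k+1)).
-- All other terms are divisible by p^(v_p(N-k)+3n): the absorption identity for binomial
-- coefficients moves the factor N-k into C(N-1-j, k-j), the power N^(k-j) supplies the rest,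
-- and for j = k-2 one uses p^n ∣ s(N, N-j) for odd j (again from the identity).  Comparing
-- both sides modulo p^(v_p(N-k)+3n) yields the two cases of the theorem.

module Binomial where
  open import Data.Nat
  open import Data.Nat.Properties
  open import Data.Nat.Combinatorics using (_C_; nC1≡n; k>n⇒nCk≡0; nCk+nC[k+1]≡[n+1]C[k+1])
  open import Relation.Binary.PropositionalEquality
  open import Relation.Nullary using (yes; no)
  open ≡-Reasoning

  absorption : ∀ n k → suc k * (n C suc k) ≡ (n ∸ k) * (n C k)
  absorption zero k rewrite k>n⇒nCk≡0 {0} {suc k} (s≤s z≤n) | 0∸n≡0 k = *-zeroʳ (suc k)
  absorption (suc n) zero = trans (+-identityʳ _) (trans (nC1≡n (suc n)) (sym (*-identityʳ (suc n))))
  absorption (suc n) (suc k) = begin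
    suc (suc k) * (suc n C suc (suc k))
      ≡⟨ cong (suc (suc k) *_) (sym (nCk+nC[k+1]≡[n+1]C[k+1] n (suc k))) ⟩
    suc (suc k) * (X + n C suc (suc k))
      ≡⟨ *-distribˡ-+ (suc (suc k)) X _ ⟩
    suc (suc k) * X + suc (suc k) * (n C suc (suc k))
      ≡⟨ cong (suc (suc k) * X +_) (absorption n (suc k)) ⟩
    suc (suc k) * X + (n ∸ suc k) * X
      ≡⟨ sym (*-distribʳ-+ X (suc (suc k)) (n ∸ suc k)) ⟩
    (suc (suc k) + (n ∸ suc k)) * X
      ≡⟨ coefficients ⟩
    (suc k + (n ∸ k)) * X
      ≡⟨ *-distribʳ-+ X (suc k) (n ∸ k) ⟩
    suc k * X + (n ∸ k) * X
      ≡⟨ cong (_+ (n ∸ k) * X) (absorption n k) ⟩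
    (n ∸ k) * (n C k) + (n ∸ k) * X
      ≡⟨ sym (*-distribˡ-+ (n ∸ k) (n C k) X) ⟩
    (n ∸ k) * (n C k + X)
      ≡⟨ cong ((n ∸ k) *_) (nCk+nC[k+1]≡[n+1]C[k+1] n k) ⟩
    (n ∸ k) * (suc n C suc k) ∎
    where
    X = n C suc k
    -- Both coefficients agree when k < n; otherwise X = 0.
    coefficients : (suc (suc k) + (n ∸ suc k)) * X ≡ (suc k + (n ∸ k)) * X
    coefficients with k <? n
    ... | yes k<n = cong (_* X) (trans (sym (+-suc (suc k) (n ∸ suc k)))
                                        (cong (suc k +_) (sym (+-∸-assoc 1 k<n))))
    ... | no k≮n rewrite k>n⇒nCk≡0 {n} {suc k} (s≤s (≮⇒≥ k≮n)) =
          trans (*-zeroʳ (suc (suc k) + (n ∸ suc k))) (sym (*-zeroʳ (suc k + (n ∸ k))))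

module FiniteSums where
  open import Data.Nat using (ℕ; zero; suc; _<_)
  open import Data.Nat.Properties using (≤-refl; m<n⇒m<1+n)
  open import Data.Integer using (ℤ; 0ℤ; _+_; _*_; -_)
  open import Data.Integer.Properties using (*-zeroʳ; *-distribˡ-+; neg-distrib-+; +-assoc; +-comm)
  open import Data.Integer.Divisibility.Signed using (_∣_; ∣m∣n⇒∣m+n; divides)
  open import Relation.Binary.PropositionalEquality
  open import Data.Integer.Tactic.RingSolver using (solve-∀)

  ∑ : ℕ → (ℕ → ℤ) → ℤ
  ∑ zero    f = 0ℤ
  ∑ (suc n) f = ∑ n f + f n

  syntax ∑ n (λ j → e) = ∑[ j < n ] e

  ∑-cong : ∀ {f g} n → (∀ j → j < n → f j ≡ g j) → ∑ n f ≡ ∑ n g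
  ∑-cong zero    eq = refl
  ∑-cong (suc n) eq = cong₂ _+_ (∑-cong n (λ j j<n → eq j (m<n⇒m<1+n j<n))) (eq n ≤-refl)

  ∑-zero : ∀ {f} n → (∀ j → f j ≡ 0ℤ) → ∑ n f ≡ 0ℤ
  ∑-zero zero    eq = refl
  ∑-zero (suc n) eq rewrite ∑-zero n eq | eq n = refl

  ∑-+ : ∀ f g n → ∑[ j < n ] (f j + g j) ≡ ∑ n f + ∑ n g
  ∑-+ f g zero    = refl
  ∑-+ f g (suc n) rewrite ∑-+ f g n = interchange (∑ n f) (∑ n g) (f n) (g n)
    where
    interchange : ∀ a b c d → a + b + (c + d) ≡ a + c + (b + d)
    interchange = solve-∀

  ∑-*ˡ : ∀ c f n → ∑[ j < n ] (c * f j) ≡ c * ∑ n f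
  ∑-*ˡ c f zero    = sym (*-zeroʳ c)
  ∑-*ˡ c f (suc n) rewrite ∑-*ˡ c f n = sym (*-distribˡ-+ c (∑ n f) (f n))

  ∑-neg : ∀ f n → ∑[ j < n ] (- f j) ≡ - ∑ n f
  ∑-neg f zero    = refl
  ∑-neg f (suc n) rewrite ∑-neg f n = sym (neg-distrib-+ (∑ n f) (f n))

  ∑-first : ∀ f n → ∑ (suc n) f ≡ f 0 + ∑[ j < n ] f (suc j)
  ∑-first f zero    = +-comm 0ℤ (f 0)
  ∑-first f (suc n) rewrite ∑-first f n = +-assoc (f 0) _ _

  ∑-∣ : ∀ {d} f n → (∀ j → j < n → d ∣ f j) → d ∣ ∑ n f
  ∑-∣ {d} f zero    dvd = divides 0ℤ refl
  ∑-∣     f (suc n) dvd = ∣m∣n⇒∣m+n (∑-∣ f n (λ j j<n → dvd j (m<n⇒m<1+n j<n))) (dvd n ≤-refl)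

module Symmetric where
  open import Data.Nat as ℕ using (ℕ; zero; suc; _∸_; _<_; _≤_; s≤s)
  import Data.Nat.Properties as ℕ
  open import Data.Nat.Combinatorics using (_C_; nCk+nC[k+1]≡[n+1]C[k+1])
  open import Data.Integer using (ℤ; +_; 0ℤ; 1ℤ; _+_; _*_; -_; _-_; _^_)
  open import Data.Integer.Properties using (*-zeroˡ; *-zeroʳ; +-identityˡ; pos-+)
  open import Data.Integer.Tactic.RingSolver using (solve-∀)
  open import Data.List using (List; []; _∷_; map; length)
  open import Data.List.Relation.Binary.Permutation.Propositional using (_↭_; refl; prep; swap; trans)
  open import Data.Sum using (inj₁; inj₂)
  open import Relation.Binary.PropositionalEquality as ≡ using (_≡_; cong; cong₂; sym)
  open ≡.≡-Reasoning
  open FiniteSums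

  esym : ℕ → List ℤ → ℤ
  esym zero    _        = 1ℤ
  esym (suc k) []       = 0ℤ
  esym (suc k) (x ∷ xs) = esym (suc k) xs + x * esym k xs

  esym-length< : ∀ k xs → length xs < k → esym k xs ≡ 0ℤ
  esym-length< (suc k) []       _ = ≡.refl
  esym-length< (suc k) (x ∷ xs) (s≤s n<k) =
    ≡.trans (cong₂ (λ a b → a + x * b) (esym-length< (suc k) xs (ℕ.m<n⇒m<1+n n<k))
                                      (esym-length< k xs n<k))
            (≡.trans (+-identityˡ (x * 0ℤ)) (*-zeroʳ x))

  esym-↭ : ∀ {xs ys} → xs ↭ ys → ∀ k → esym k xs ≡ esym k ys
  esym-↭ refl         k             = ≡.refl
  esym-↭ (prep x p)   zero          = ≡.refl
  esym-↭ (prep x p)   (suc k)       = cong₂ (λ a b → a + x * b) (esym-↭ p (suc k)) (esym-↭ p k)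
  esym-↭ (swap x y p) zero          = ≡.refl
  esym-↭ {_ ∷ _ ∷ _} {_ ∷ _ ∷ ys} (swap x y p) (suc zero)
    rewrite esym-↭ p 1 = exchange (esym 1 ys) x y
    where
    exchange : ∀ a x y → a + y * 1ℤ + x * 1ℤ ≡ a + x * 1ℤ + y * 1ℤ
    exchange = solve-∀
  esym-↭ {_ ∷ _ ∷ _} {_ ∷ _ ∷ ys} (swap x y p) (suc (suc k))
    rewrite esym-↭ p (suc (suc k)) | esym-↭ p (suc k) | esym-↭ p k =
      exchange (esym (suc (suc k)) ys) (esym (suc k) ys) (esym k ys) x y
    where
    exchange : ∀ a b c x y → a + y * b + x * (b + y * c) ≡ a + x * b + y * (b + x * c)
    exchange = solve-∀
  esym-↭ (trans p q)  k             = ≡.trans (esym-↭ p k) (esym-↭ q k)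

  -- e_{j-1}, with the convention e_{-1} = 0, so that e_j(x ∷ xs) = e_j(xs) + x·e_{j-1}(xs)
  -- holds for every j.
  esymPred : ℕ → List ℤ → ℤ
  esymPred zero    _  = 0ℤ
  esymPred (suc j) xs = esym j xs

  esym-∷ : ∀ j x xs → esym j (x ∷ xs) ≡ esym j xs + x * esymPred j xs
  esym-∷ zero    x xs = sym (≡.trans (cong (λ z → 1ℤ + z) (*-zeroʳ x)) (+-identityˡ 1ℤ))
  esym-∷ (suc j) x xs = ≡.refl

  sign : ℕ → ℤ
  sign zero    = 1ℤ
  sign (suc j) = - sign j

  reflCoeff : ℤ → ℕ → ℕ → ℕ → ℤ
  reflCoeff c n k j = sign j * + ((n ∸ j) C (k ∸ j)) * c ^ (k ∸ j)

  reflTerm : ℤ → List ℤ → ℕ → ℕ → ℤ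
  reflTerm c xs k j = reflCoeff c (length xs) k j * esym j xs

  reflCoeff-pascal : ∀ c n k j → j ≤ k → j ≤ n →
    reflCoeff c (suc n) (suc k) j ≡ reflCoeff c n (suc k) j + c * reflCoeff c n k j
  reflCoeff-pascal c n k j j≤k j≤n
    rewrite ℕ.+-∸-assoc 1 j≤k | ℕ.+-∸-assoc 1 j≤n
          | sym (nCk+nC[k+1]≡[n+1]C[k+1] (n ∸ j) (k ∸ j))
          | pos-+ ((n ∸ j) C (k ∸ j)) ((n ∸ j) C suc (k ∸ j)) =
      regroup (sign j) (+ ((n ∸ j) C (k ∸ j))) (+ ((n ∸ j) C suc (k ∸ j))) c (c ^ (k ∸ j))
    where
    regroup : ∀ s P Q c w → s * (P + Q) * (c * w) ≡ s * Q * (c * w) + c * (s * P * w)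
    regroup = solve-∀

  -- The reflection formula: for c ∈ ℤ and a list xs of length n,
  --   e_k(c - x₁, …, c - xₙ) = ∑_{j ≤ k} (-1)^j C(n-j, k-j) c^(k-j) e_j(x₁, …, xₙ),
  -- the coefficient of t^k in ∏ ((1 + ct) - xᵢt).
  reflection : ∀ c xs k → esym k (map (λ x → c - x) xs) ≡ ∑[ j < suc k ] reflTerm c xs k j
  reflection c []       zero    = ≡.refl
  reflection c []       (suc k) = sym (∑-zero (suc (suc k)) vanish)
    where
    vanish : ∀ j → reflTerm c [] (suc k) j ≡ 0ℤ
    vanish zero    = cong (_* 1ℤ) (*-zeroˡ (c ^ suc k))
    vanish (suc j) = *-zeroʳ (reflCoeff c 0 (suc k) (suc j))
  reflection c (x ∷ xs) zero    = ≡.refl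
  reflection c (x ∷ xs) (suc k) = begin
      esym (suc k) (map (λ x → c - x) xs) + (c - x) * esym k (map (λ x → c - x) xs)
    ≡⟨ cong₂ (λ a b → a + (c - x) * b) (reflection c xs (suc k)) (reflection c xs k) ⟩
      F₁ + (c - x) * F₀
    ≡⟨ regroup F₁ F₀ c x ⟩
      (F₁ + c * F₀) + x * (- F₀)
    ≡⟨ cong₂ (λ a b → a + x * b) (sym pascalPart) (sym shiftPart) ⟩
      ∑ (suc (suc k)) A + x * ∑ (suc (suc k)) B
    ≡⟨ cong (λ z → ∑ (suc (suc k)) A + z) (sym (∑-*ˡ x B (suc (suc k)))) ⟩
      ∑ (suc (suc k)) A + ∑[ j < suc (suc k) ] (x * B j)
    ≡⟨ sym (∑-+ A (λ j → x * B j) (suc (suc k))) ⟩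
      ∑[ j < suc (suc k) ] (A j + x * B j)
    ≡⟨ ∑-cong (suc (suc k)) (λ j _ → sym (split j)) ⟩
      ∑[ j < suc (suc k) ] reflTerm c (x ∷ xs) (suc k) j
    ∎
    where
    n = length xs
    F₁ F₀ : ℤ
    F₁ = ∑[ j < suc (suc k) ] reflTerm c xs (suc k) j
    F₀ = ∑[ j < suc k ] reflTerm c xs k j
    A B : ℕ → ℤ
    A j = reflCoeff c (suc n) (suc k) j * esym j xs
    B j = reflCoeff c (suc n) (suc k) j * esymPred j xs

    regroup : ∀ F₁ F₀ c x → F₁ + (c - x) * F₀ ≡ (F₁ + c * F₀) + x * (- F₀)
    regroup = solve-∀

    split : ∀ j → reflTerm c (x ∷ xs) (suc k) j ≡ A j + x * B j
    split j = ≡.trans (cong (reflCoeff c (suc n) (suc k) j *_) (esym-∷ j x xs))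
                      (distrib (reflCoeff c (suc n) (suc k) j) (esym j xs) x (esymPred j xs))
      where
      distrib : ∀ a e x f → a * (e + x * f) ≡ a * e + x * (a * f)
      distrib = solve-∀

    pascalTerm : ∀ j → j < suc k → A j ≡ reflTerm c xs (suc k) j + c * reflTerm c xs k j
    pascalTerm j (s≤s j≤k) with ℕ.≤-<-connex j n
    ... | inj₁ j≤n = ≡.trans (cong (_* esym j xs) (reflCoeff-pascal c n k j j≤k j≤n))
                             (distrib (reflCoeff c n (suc k) j) (reflCoeff c n k j) c (esym j xs))
      where
      distrib : ∀ a b c e → (a + c * b) * e ≡ a * e + c * (b * e)
      distrib = solve-∀
    ... | inj₂ n<j rewrite esym-length< j xs n<j
                         | *-zeroʳ (reflCoeff c (suc n) (suc k) j)
                         | *-zeroʳ (reflCoeff c n (suc k) j)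
                         | *-zeroʳ (reflCoeff c n k j) = sym (≡.trans (+-identityˡ (c * 0ℤ)) (*-zeroʳ c))

    pascalPart : ∑ (suc (suc k)) A ≡ F₁ + c * F₀
    pascalPart = begin
        ∑ (suc k) A + A (suc k)
      ≡⟨ cong (_+ A (suc k)) (∑-cong (suc k) pascalTerm) ⟩
        ∑[ j < suc k ] (reflTerm c xs (suc k) j + c * reflTerm c xs k j) + A (suc k)
      ≡⟨ cong (_+ A (suc k)) (≡.trans (∑-+ _ _ (suc k)) (cong (λ z → S₁ + z) (∑-*ˡ c _ (suc k)))) ⟩
        S₁ + c * F₀ + A (suc k)
      ≡⟨ cong (λ z → S₁ + c * F₀ + z) lastTerm ⟩
        S₁ + c * F₀ + reflTerm c xs (suc k) (suc k)
      ≡⟨ swapLast S₁ (c * F₀) (reflTerm c xs (suc k) (suc k)) ⟩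
        F₁ + c * F₀
      ∎
      where
      S₁ = ∑[ j < suc k ] reflTerm c xs (suc k) j
      -- Both top terms have binomial coefficient C(_, 0) = 1.
      lastTerm : A (suc k) ≡ reflTerm c xs (suc k) (suc k)
      lastTerm rewrite ℕ.n∸n≡0 k = ≡.refl
      swapLast : ∀ a b t → a + b + t ≡ a + t + b
      swapLast = solve-∀

    shiftPart : ∑ (suc (suc k)) B ≡ - F₀
    shiftPart = begin
        ∑ (suc (suc k)) B
      ≡⟨ ∑-first B (suc k) ⟩
        B 0 + ∑[ j < suc k ] B (suc j)
      ≡⟨ cong₂ _+_ (*-zeroʳ (reflCoeff c (suc n) (suc k) 0))
                   (∑-cong (suc k) (λ j _ → negTerm (sign j) (+ ((n ∸ j) C (k ∸ j))) (c ^ (k ∸ j)) (esym j xs))) ⟩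
        0ℤ + ∑[ j < suc k ] (- reflTerm c xs k j)
      ≡⟨ ≡.trans (+-identityˡ _) (∑-neg (reflTerm c xs k) (suc k)) ⟩
        - F₀
      ∎
      where
      negTerm : ∀ s b w e → - s * b * w * e ≡ - (s * b * w * e)
      negTerm = solve-∀

module StirlingSymmetric where
  open import Data.Nat as ℕ using (ℕ; zero; suc; _∸_; _<_; _≤_; s≤s)
  import Data.Nat.Properties as ℕ
  open import Data.Nat.Combinatorics using (_C_)
  open import Data.Integer using (ℤ; +_; 1ℤ; _+_; _*_; -_; _-_; _^_)
  open import Data.Integer.Properties using (pos-+; pos-*; +-comm; neg-involutive)
  open import Data.Integer.Tactic.RingSolver using (solve-∀)
  open import Data.List using (List; []; _∷_; _∷ʳ_; map; length; reverse)
  import Data.List.Properties as List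
  open import Data.List.Relation.Binary.Permutation.Propositional.Properties using (↭-reverse)
  open import Data.Sum using (inj₁; inj₂)
  open import Function using (_∘_)
  open import Relation.Binary.PropositionalEquality
  open ≡-Reasoning
  open import Defs using (stirling1)
  open FiniteSums
  open Symmetric

  stirling1-above : ∀ n j → stirling1 n (suc n ℕ.+ j) ≡ 0
  stirling1-above zero    j = refl
  stirling1-above (suc n) j =
    trans (cong₂ (λ a b → n ℕ.* a ℕ.+ b)
                 (trans (cong (λ i → stirling1 n (suc i)) (sym (ℕ.+-suc n j))) (stirling1-above n (suc j)))
                 (stirling1-above n j))
          (trans (ℕ.+-identityʳ (n ℕ.* 0)) (ℕ.*-zeroʳ n))

  stirling1-diag : ∀ n → stirling1 n n ≡ 1
  stirling1-diag zero    = refl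
  stirling1-diag (suc n)
    rewrite stirling1-diag n | cong (stirling1 n) (sym (ℕ.+-identityʳ (suc n)))
          | stirling1-above n 0 | ℕ.*-zeroʳ n = refl

  U : ℕ → List ℤ
  U zero    = []
  U (suc m) = + suc m ∷ U m

  length-U : ∀ m → length (U m) ≡ m
  length-U zero    = refl
  length-U (suc m) = cong suc (length-U m)

  -- s(m+1, m+1-k) = e_k(1, 2, …, m): the roots of x(x+1)⋯(x+m) are 0, -1, …, -m.
  stirling1-esym : ∀ m k → k ≤ suc m → + stirling1 (suc m) (suc m ∸ k) ≡ esym k (U m)
  stirling1-esym m       zero    _ = cong +_ (stirling1-diag (suc m))
  stirling1-esym zero    (suc zero) _ = refl
  stirling1-esym zero    (suc (suc k)) (s≤s ())
  stirling1-esym (suc m) (suc k) (s≤s k≤m+1) with ℕ.m≤n⇒m<n∨m≡n k≤m+1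
  ... | inj₂ refl rewrite ℕ.n∸n≡0 m = sym (esym-length< (suc (suc m)) (U (suc m))
                           (subst (_< suc (suc m)) (sym (length-U (suc m))) ℕ.≤-refl))
  ... | inj₁ (s≤s k≤m) rewrite ℕ.+-∸-assoc 1 k≤m = begin
      + (suc m ℕ.* stirling1 (suc m) (suc (m ∸ k)) ℕ.+ stirling1 (suc m) (m ∸ k))
    ≡⟨ pos-+ (suc m ℕ.* stirling1 (suc m) (suc (m ∸ k))) _ ⟩
      + (suc m ℕ.* stirling1 (suc m) (suc (m ∸ k))) + + stirling1 (suc m) (m ∸ k)
    ≡⟨ cong (_+ + stirling1 (suc m) (m ∸ k)) (pos-* (suc m) _) ⟩
      + suc m * + stirling1 (suc m) (suc (m ∸ k)) + + stirling1 (suc m) (m ∸ k)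
    ≡⟨ cong₂ (λ a b → + suc m * a + b) lower (stirling1-esym m (suc k) (s≤s k≤m)) ⟩
      + suc m * esym k (U m) + esym (suc k) (U m)
    ≡⟨ +-comm (+ suc m * esym k (U m)) _ ⟩
      esym (suc k) (U (suc m))
    ∎
    where
    lower : + stirling1 (suc m) (suc (m ∸ k)) ≡ esym k (U m)
    lower = trans (cong (λ i → + stirling1 (suc m) i) (sym (ℕ.+-∸-assoc 1 k≤m)))
                  (stirling1-esym m k (ℕ.m≤n⇒m≤1+n k≤m))

  U-suc : ∀ m → U (suc m) ≡ map (λ x → 1ℤ + x) (U m) ∷ʳ 1ℤ
  U-suc zero    = refl
  U-suc (suc m) = cong (+ suc (suc m) ∷_) (U-suc m)

  U-symmetric : ∀ m → map (λ x → + suc m - x) (U m) ≡ reverse (U m)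
  U-symmetric zero    = refl
  U-symmetric (suc m) = begin
      map (λ x → + suc (suc m) - x) (U (suc m))
    ≡⟨ cong (map (λ x → + suc (suc m) - x)) (U-suc m) ⟩
      map (λ x → + suc (suc m) - x) (map (λ x → 1ℤ + x) (U m) ∷ʳ 1ℤ)
    ≡⟨ List.map-++ (λ x → + suc (suc m) - x) (map (λ x → 1ℤ + x) (U m)) _ ⟩
      map (λ x → + suc (suc m) - x) (map (λ x → 1ℤ + x) (U m)) ∷ʳ (+ suc (suc m) - 1ℤ)
    ≡⟨ cong₂ _∷ʳ_ (sym (List.map-∘ (U m))) (cancelOne (+ suc m)) ⟩
      map ((λ x → + suc (suc m) - x) ∘ (λ x → 1ℤ + x)) (U m) ∷ʳ + suc m
    ≡⟨ cong (_∷ʳ + suc m) (List.map-cong (cancel (+ suc m)) (U m)) ⟩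
      map (λ x → + suc m - x) (U m) ∷ʳ + suc m
    ≡⟨ cong (_∷ʳ + suc m) (U-symmetric m) ⟩
      reverse (U m) ∷ʳ + suc m
    ≡⟨ sym (List.unfold-reverse (+ suc m) (U m)) ⟩
      reverse (U (suc m))
    ∎
    where
    cancel : ∀ a x → (1ℤ + a) - (1ℤ + x) ≡ a - x
    cancel = solve-∀
    cancelOne : ∀ a → (1ℤ + a) - 1ℤ ≡ a
    cancelOne = solve-∀

  esym-U-reflection : ∀ m k → esym k (U m) ≡ ∑[ j < suc k ] reflTerm (+ suc m) (U m) k j
  esym-U-reflection m k = begin
      esym k (U m)
    ≡⟨ sym (esym-↭ (↭-reverse (U m)) k) ⟩
      esym k (reverse (U m))
    ≡⟨ cong (esym k) (sym (U-symmetric m)) ⟩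
      esym k (map (λ x → + suc m - x) (U m))
    ≡⟨ reflection (+ suc m) (U m) k ⟩
      ∑[ j < suc k ] reflTerm (+ suc m) (U m) k j
    ∎

  pos-^ : ∀ a x → (+ a) ^ x ≡ + (a ℕ.^ x)
  pos-^ a zero    = refl
  pos-^ a (suc x) = trans (cong (+ a *_) (pos-^ a x)) (sym (pos-* a (a ℕ.^ x)))

  sign-even : ∀ h → sign (2 ℕ.* h) ≡ 1ℤ
  sign-even zero    = refl
  sign-even (suc h) = trans (cong sign (ℕ.*-suc 2 h)) (trans (neg-involutive (sign (2 ℕ.* h))) (sign-even h))

  stirlingTerm : ℕ → ℕ → ℕ → ℕ
  stirlingTerm m k j = ((m ∸ j) C (k ∸ j)) ℕ.* suc m ℕ.^ (k ∸ j) ℕ.* stirling1 (suc m) (suc m ∸ j)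

  reflTerm-U : ∀ m k j → j ≤ suc m → reflTerm (+ suc m) (U m) k j ≡ sign j * + stirlingTerm m k j
  reflTerm-U m k j j≤ rewrite length-U m = begin
      sign j * + B * (+ suc m) ^ (k ∸ j) * esym j (U m)
    ≡⟨ cong₂ (λ a b → sign j * + B * a * b) (pos-^ (suc m) (k ∸ j)) (sym (stirling1-esym m j j≤)) ⟩
      sign j * + B * + P * + S
    ≡⟨ reassoc (sign j) (+ B) (+ P) (+ S) ⟩
      sign j * (+ B * + P * + S)
    ≡⟨ cong (sign j *_) (sym (trans (pos-* (B ℕ.* P) S) (cong (_* + S) (pos-* B P)))) ⟩
      sign j * + stirlingTerm m k j
    ∎
    where
    B = (m ∸ j) C (k ∸ j)
    P = suc m ℕ.^ (k ∸ j)
    S = stirling1 (suc m) (suc m ∸ j)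
    reassoc : ∀ a b c d → a * b * c * d ≡ a * (b * c * d)
    reassoc = solve-∀

  -- For odd k = 2h+1 the top reflection term is -s(m+1, m+1-k), so moving it to the
  -- left-hand side expresses 2·s(m+1, m+1-k) through the lower Stirling numbers.
  twice-stirling1 : ∀ m h → suc (2 ℕ.* h) ≤ suc m →
    + (2 ℕ.* stirling1 (suc m) (suc m ∸ suc (2 ℕ.* h)))
      ≡ ∑[ j < suc (2 ℕ.* h) ] (sign j * + stirlingTerm m (suc (2 ℕ.* h)) j)
  twice-stirling1 m h k≤ = begin
      + (2 ℕ.* stirling1 (suc m) (suc m ∸ k))
    ≡⟨ trans (pos-* 2 (stirling1 (suc m) (suc m ∸ k))) (cong (+ 2 *_) (stirling1-esym m k k≤)) ⟩
      + 2 * e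
    ≡⟨ doubling e S (trans (esym-U-reflection m k) (cong (λ t → S + t) topTerm)) ⟩
      S
    ≡⟨ ∑-cong k (λ j j<k → reflTerm-U m k j (ℕ.≤-trans (ℕ.<⇒≤ j<k) k≤)) ⟩
      ∑[ j < k ] (sign j * + stirlingTerm m k j)
    ∎
    where
    k = suc (2 ℕ.* h)
    e = esym k (U m)
    S = ∑[ j < k ] reflTerm (+ suc m) (U m) k j
    topTerm : reflTerm (+ suc m) (U m) k k ≡ - e
    topTerm rewrite ℕ.n∸n≡0 k | sign-even h = negate e
      where
      negate : ∀ x → - 1ℤ * 1ℤ * 1ℤ * x ≡ - x
      negate = solve-∀
    doubling : ∀ x S → x ≡ S + - x → + 2 * x ≡ S
    doubling x S eq = trans (twice x) (trans (cong (_+ x) eq) (cancel S x))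
      where
      twice : ∀ x → + 2 * x ≡ x + x
      twice = solve-∀
      cancel : ∀ S x → S + - x + x ≡ S
      cancel = solve-∀

module ExponentBound where
  open import Data.Nat
  open import Data.Nat.Properties
  open import Relation.Binary.PropositionalEquality using (subst; cong; sym)

  t+4≤5^[1+t] : ∀ t → suc t + 3 ≤ 5 ^ suc t
  t+4≤5^[1+t] zero    = s≤s (s≤s (s≤s (s≤s z≤n)))
  t+4≤5^[1+t] (suc t) = ≤-trans (s≤s (t+4≤5^[1+t] t)) (suc≤5* (5 ^ suc t) (m^n>0 5 (suc t)))
    where
    suc≤5* : ∀ x → 1 ≤ x → suc x ≤ 5 * x
    suc≤5* x 1≤x = subst (_≤ 5 * x) (+-comm x 1) (+-monoʳ-≤ x (≤-trans 1≤x (m≤m+n x _)))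

  exponent+3≤ : ∀ {p} t D′ → 5 ≤ p → 0 < D′ → 3 ≤ p ^ t * D′ → t + 3 ≤ p ^ t * D′
  exponent+3≤         zero     D′ _   _    3≤D = 3≤D
  exponent+3≤ {p} (suc t) D′ 5≤p 0<D′ _   = begin
    suc t + 3           ≤⟨ t+4≤5^[1+t] t ⟩
    5 ^ suc t           ≤⟨ ^-monoˡ-≤ (suc t) 5≤p ⟩
    p ^ suc t           ≤⟨ m≤m*n (p ^ suc t) D′ {{>-nonZero 0<D′}} ⟩
    p ^ suc t * D′      ∎
    where open ≤-Reasoning

  exponent+3n≤ : ∀ {t D} n → 1 ≤ n → t + 3 ≤ D → t + 3 * n ≤ n * D
  exponent+3n≤ {t} {D} n 1≤n t+3≤D = begin
    t + 3 * n     ≤⟨ +-monoˡ-≤ (3 * n) (subst (_≤ n * t) (*-identityˡ t) (*-monoˡ-≤ t 1≤n)) ⟩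
    n * t + 3 * n ≡⟨ cong (n * t +_) (*-comm 3 n) ⟩
    n * t + n * 3 ≡⟨ sym (*-distribˡ-+ n t 3) ⟩
    n * (t + 3)   ≤⟨ *-monoʳ-≤ n t+3≤D ⟩
    n * D         ∎
    where open ≤-Reasoning

module Valuation where
  open import Data.Nat
  open import Data.Nat.Properties
  open import Data.Nat.Divisibility
  open import Data.Nat.Primality using (Prime; prime⇒nonZero; prime⇒nonTrivial; euclidsLemma)
  open import Data.Nat.Induction using (<-rec)
  open import Data.Nat.GCD using (gcd; gcd-greatest)
  open import Data.Product using (Σ; _×_; _,_; proj₁)
  open import Data.Sum using ([_,_]′)
  open import Data.Empty using (⊥-elim)
  open import Relation.Nullary using (¬_; yes; no)
  open import Relation.Binary.PropositionalEquality
  open import Data.Nat.Tactic.RingSolver using (solve-∀)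
  open import Defs using (ValP)
  open ExponentBound

  ^-monoʳ-∣ : ∀ a {x y} → x ≤ y → a ^ x ∣ a ^ y
  ^-monoʳ-∣ a {x} {y} x≤y = divides (a ^ (y ∸ x)) (begin
      a ^ y               ≡⟨ cong (a ^_) (sym (m+[n∸m]≡n x≤y)) ⟩
      a ^ (x + (y ∸ x))   ≡⟨ ^-distribˡ-+-* a x (y ∸ x) ⟩
      a ^ x * a ^ (y ∸ x) ≡⟨ *-comm (a ^ x) _ ⟩
      a ^ (y ∸ x) * a ^ x ∎)
    where open ≡-Reasoning

  ^-monoˡ-∣ : ∀ {a b} x → a ∣ b → a ^ x ∣ b ^ x
  ^-monoˡ-∣ zero    _   = ∣-refl
  ^-monoˡ-∣ (suc x) a∣b = *-pres-∣ a∣b (^-monoˡ-∣ x a∣b)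

  module _ {p : ℕ} (p-prime : Prime p) where
    instance
      p≢0 : NonZero p
      p≢0 = prime⇒nonZero p-prime

    p^≢0 : ∀ x → NonZero (p ^ x)
    p^≢0 x = m^n≢0 p x

    1<p : 1 < p
    1<p = nonTrivial⇒n>1 p {{prime⇒nonTrivial p-prime}}

    cancel-coprime : ∀ {c} → ¬ p ∣ c → ∀ x y → p ^ x ∣ c * y → p ^ x ∣ y
    cancel-coprime _  zero    y _ = divides y (sym (*-identityʳ y))
    cancel-coprime {c} p∤c (suc x) y p^x+1∣cy
      with cancel-coprime p∤c x y (∣-trans (^-monoʳ-∣ p (n≤1+n x)) p^x+1∣cy)
    ... | divides y′ refl = *-monoˡ-∣ (p ^ x) p∣y′
      where
      p∣cy′ : p ∣ c * y′
      p∣cy′ = *-cancelʳ-∣ (p ^ x) {{p^≢0 x}}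
                (subst (p * p ^ x ∣_) (sym (*-assoc c y′ (p ^ x))) p^x+1∣cy)
      p∣y′ : p ∣ y′
      p∣y′ = [ (λ p∣c → ⊥-elim (p∤c p∣c)) , (λ p∣y′ → p∣y′) ]′ (euclidsLemma c y′ p-prime p∣cy′)

    split-p-power : ∀ D → 0 < D → Σ ℕ λ t → Σ ℕ λ D′ → D ≡ p ^ t * D′ × ¬ p ∣ D′
    split-p-power = <-rec _ step
      where
      Split : ℕ → Set
      Split D = Σ ℕ λ t → Σ ℕ λ D′ → D ≡ p ^ t * D′ × ¬ p ∣ D′
      step : ∀ D → (∀ {E} → E < D → 0 < E → Split E) → 0 < D → Split D
      step D rec 0<D with p ∣? D
      ... | no p∤D = 0 , D , sym (+-identityʳ D) , p∤D
      ... | yes (divides E refl) with rec E<D 0<E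
        where
        0<E : 0 < E
        0<E = n≢0⇒n>0 λ { refl → <⇒≢ 0<D refl }
        E<D : E < E * p
        E<D = m<m*n E p {{>-nonZero 0<E}} 1<p
      ... | t , D′ , refl , p∤D′ = suc t , D′ , reorder p (p ^ t) D′ , p∤D′
        where
        reorder : ∀ a b c → b * c * a ≡ a * b * c
        reorder = solve-∀

    ValP-bound : ∀ {m x z} → ValP p m x → p ^ z ∣ m → z ≤ x
    ValP-bound {x = x} {z} (_ , p^x+1∤m) p^z∣m with z ≤? x
    ... | yes z≤x = z≤x
    ... | no  z≰x = ⊥-elim (p^x+1∤m (∣-trans (^-monoʳ-∣ p (≰⇒> z≰x)) p^z∣m))

    ValP-unique : ∀ {m x y} → ValP p m x → ValP p m y → x ≡ y
    ValP-unique vx vy = ≤-antisym (ValP-bound vy (proj₁ vx)) (ValP-bound vx (proj₁ vy))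

    ValP-cancel : ∀ {c y w} → ¬ p ∣ c → ValP p (c * y) w → ValP p y w
    ValP-cancel {c} {y} {w} p∤c (p^w∣cy , p^w+1∤cy) =
      cancel-coprime p∤c w y p^w∣cy , λ p^w+1∣y → p^w+1∤cy (∣n⇒∣m*n c p^w+1∣y)

    ValP-unit-multiple : ∀ {a} n → ¬ p ∣ a → ValP p (a * p ^ n) n
    ValP-unit-multiple {a} n p∤a =
      n∣m*n a , λ p^n+1∣ap^n → p∤a (*-cancelʳ-∣ (p ^ n) {{p^≢0 n}} p^n+1∣ap^n)

    gcd≡1⇒∤ : ∀ {a} → gcd a p ≡ 1 → ¬ p ∣ a
    gcd≡1⇒∤ {a} gcd≡1 p∣a = <⇒≢ 1<p (sym (∣1⇒≡1 (subst (p ∣_) gcd≡1 (gcd-greatest p∣a ∣-refl))))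

    ValP-* : ∀ {m m′ x y} → ValP p m x → ValP p m′ y → ValP p (m * m′) (x + y)
    ValP-* {x = x} {y} (divides u refl , p^x+1∤m) (divides v refl , p^y+1∤m′) =
      subst (_∣ u * p ^ x * (v * p ^ y)) (sym (^-distribˡ-+-* p x y)) (*-pres-∣ (n∣m*n u) (n∣m*n v)) ,
      λ p^x+y+1∣mm′ → [ p∤u , p∤v ]′ (euclidsLemma u v p-prime (*-cancelʳ-∣ (p ^ (x + y)) {{p^≢0 (x + y)}}
        (subst (p * p ^ (x + y) ∣_) (regroup u v) p^x+y+1∣mm′)))
      where
      p∤u : ¬ p ∣ u
      p∤u p∣u = p^x+1∤m (*-monoˡ-∣ (p ^ x) p∣u)
      p∤v : ¬ p ∣ v
      p∤v p∣v = p^y+1∤m′ (*-monoˡ-∣ (p ^ y) p∣v)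
      regroup : ∀ u v → u * p ^ x * (v * p ^ y) ≡ u * v * p ^ (x + y)
      regroup u v = trans (rearrange u (p ^ x) v (p ^ y)) (cong (u * v *_) (sym (^-distribˡ-+-* p x y)))
        where
        rearrange : ∀ u a v b → u * a * (v * b) ≡ u * v * (a * b)
        rearrange = solve-∀

    -- If p^e ∣ D·B with D ≥ 3 and p ≥ 5, then trading the factor D for (p^n)^D gains
    -- at least 3n powers of p: the p-part p^t of D is tiny compared with p^(nD).
    power-absorbs : ∀ {e n D B} → 5 ≤ p → 1 ≤ n → 3 ≤ D → p ^ e ∣ D * B → p ^ (e + 3 * n) ∣ B * (p ^ n) ^ D
    power-absorbs {e} {n} {D} {B} 5≤p 1≤n 3≤D p^e∣DB with split-p-power D (≤-trans (s≤s z≤n) 3≤D)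
    ... | t , D′ , refl , p∤D′ = *-cancelˡ-∣ (p ^ t) {{p^≢0 t}} (begin
        p ^ t * p ^ (e + 3 * n)     ≡⟨ sym (^-distribˡ-+-* p t (e + 3 * n)) ⟩
        p ^ (t + (e + 3 * n))       ∣⟨ ^-monoʳ-∣ p exponents ⟩
        p ^ (e + n * D)             ≡⟨ ^-distribˡ-+-* p e (n * D) ⟩
        p ^ e * p ^ (n * D)         ≡⟨ cong (p ^ e *_) (sym (^-*-assoc p n D)) ⟩
        p ^ e * (p ^ n) ^ D         ∣⟨ *-monoˡ-∣ ((p ^ n) ^ D) p^e∣p^tB ⟩
        p ^ t * B * (p ^ n) ^ D     ≡⟨ *-assoc (p ^ t) B ((p ^ n) ^ D) ⟩
        p ^ t * (B * (p ^ n) ^ D)   ∎)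
      where
      open ∣-Reasoning
      0<D′ : 0 < D′
      0<D′ = n≢0⇒n>0 λ { refl → n≮0 (subst (3 ≤_) (*-zeroʳ (p ^ t)) 3≤D) }
      p^e∣p^tB : p ^ e ∣ p ^ t * B
      p^e∣p^tB = cancel-coprime p∤D′ e (p ^ t * B)
                   (subst (p ^ e ∣_) (rearrange (p ^ t) D′ B) p^e∣DB)
        where
        rearrange : ∀ a b c → a * b * c ≡ b * (a * c)
        rearrange = solve-∀
      exponents : t + (e + 3 * n) ≤ e + n * D
      exponents = ≤-trans (≤-reflexive (rearrange t e (3 * n)))
                          (+-monoʳ-≤ e (exponent+3n≤ n 1≤n (exponent+3≤ t D′ 5≤p 0<D′ 3≤D)))
        where
        rearrange : ∀ a b c → a + (b + c) ≡ b + (a + c)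
        rearrange = solve-∀

module Congruence where
  open import Data.Nat using (ℕ; _<_; _≤_; _^_)
  open import Data.Nat.Properties using (<⇒≤)
  open import Data.Nat.Divisibility using (_∣_)
  open import Data.Integer using (+_; _+_; _*_)
  import Data.Integer.Divisibility.Signed as ℤ
  open import Data.Product using (_,_)
  open import Relation.Binary.PropositionalEquality using (_≡_; subst; sym)
  open import Defs using (ValP)
  open FiniteSums
  open Symmetric using (sign)
  open Valuation using (^-monoʳ-∣)

  ∣-congruent : ∀ {d A B R} → + A ≡ R + + B → + d ℤ.∣ R → d ∣ B → d ∣ A
  ∣-congruent {d} eq d∣R d∣B = ℤ.∣⇒∣ᵤ (subst (+ d ℤ.∣_) (sym eq) (ℤ.∣m∣n⇒∣m+n d∣R (ℤ.∣ᵤ⇒∣ d∣B)))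

  ∣-congruent⁻¹ : ∀ {d A B R} → + A ≡ R + + B → + d ℤ.∣ R → d ∣ A → d ∣ B
  ∣-congruent⁻¹ {d} eq d∣R d∣A = ℤ.∣⇒∣ᵤ (ℤ.∣m+n∣m⇒∣n (subst (+ d ℤ.∣_) eq (ℤ.∣ᵤ⇒∣ d∣A)) d∣R)

  ValP-congruent : ∀ {p A B R w z} → + A ≡ R + + B → + (p ^ z) ℤ.∣ R → w < z → ValP p B w → ValP p A w
  ValP-congruent {p} {R = R} {w} {z} eq p^z∣R w<z (p^w∣B , p^w+1∤B) =
    ∣-congruent eq (divides-R (<⇒≤ w<z)) p^w∣B ,
    λ p^w+1∣A → p^w+1∤B (∣-congruent⁻¹ eq (divides-R w<z) p^w+1∣A)
    where
    divides-R : ∀ {y} → y ≤ z → + (p ^ y) ℤ.∣ R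
    divides-R y≤z = ℤ.∣-trans (ℤ.∣ᵤ⇒∣ (^-monoʳ-∣ p y≤z)) p^z∣R

  signed-∑-∣ : ∀ {d} (f : ℕ → ℕ) k → (∀ j → j < k → d ∣ f j) → + d ℤ.∣ ∑[ j < k ] (sign j * + f j)
  signed-∑-∣ f k dvd = ∑-∣ (λ j → sign j * + f j) k (λ j j<k → ℤ.∣n⇒∣m*n (sign j) (ℤ.∣ᵤ⇒∣ (dvd j j<k)))

module OddStirlingValuation where
  open import Data.Nat
  open import Data.Nat.Properties
  open import Data.Nat.Divisibility
  open import Data.Nat.Primality using (Prime)
  open import Data.Nat.Combinatorics using (_C_; nC1≡n)
  open import Data.Product using (Σ; _×_; _,_; proj₁)
  open import Relation.Nullary using (¬_)
  open import Data.Empty using (⊥-elim)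
  open import Relation.Binary.PropositionalEquality
  open import Data.Nat.Tactic.RingSolver using (solve-∀)
  import Data.Integer as ℤ
  import Data.Integer.Properties as ℤ
  import Data.Integer.Divisibility.Signed as ℤ∣
  open import Data.Integer using (+_)
  open import Defs
  open Binomial
  open FiniteSums
  open Symmetric using (sign)
  open StirlingSymmetric
  open Valuation
  open Congruence

  odd-form : ∀ k → ¬ 2 ∣ k → Σ ℕ λ h → k ≡ suc (2 * h)
  odd-form zero          2∤k = ⊥-elim (2∤k (divides 0 refl))
  odd-form (suc zero)    _   = 0 , refl
  odd-form (suc (suc k)) 2∤k with odd-form k (λ 2∣k → 2∤k (∣m∣n⇒∣m+n ∣-refl 2∣k))
  ... | h , refl = suc h , cong suc (sym (*-suc 2 h))

  odd-predecessor : ∀ {i h} → suc i ≡ 2 * h → Σ ℕ λ g → i ≡ suc (2 * g)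
  odd-predecessor {h = suc g} eq = g , suc-injective (trans eq (*-suc 2 g))

  below-3n : ∀ e {n e₁} → 1 ≤ n → e₁ ≤ 2 * n ∸ 1 → e + n + e₁ < e + 3 * n
  below-3n e {suc n} {e₁} _ e₁≤ = ≤-trans (s≤s (+-monoʳ-≤ (e + suc n) e₁≤)) (≤-reflexive (expand e n))
    where
    expand : ∀ e n → suc (e + suc n + (n + suc (n + 0))) ≡ e + 3 * suc n
    expand = solve-∀

  above-3n : ∀ e n {e₁} → 2 * n ≤ e₁ → e + 3 * n ≤ e + n + e₁
  above-3n e n {e₁} 2n≤e₁ = ≤-trans (≤-reflexive (split e n)) (+-monoʳ-≤ (e + n) 2n≤e₁)
    where
    split : ∀ e n → e + 3 * n ≡ e + n + 2 * n
    split = solve-∀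

  module _ {p} (p-prime : Prime p) (5≤p : 5 ≤ p) {n} (1≤n : 1 ≤ n) {m} (vN : ValP p (suc m) n) where
    N q : ℕ
    N = suc m
    q = p ^ n

    s : ℕ → ℕ
    s j = stirling1 N (N ∸ j)

    p∤2 : ¬ p ∣ 2
    p∤2 p∣2 = <⇒≱ (≤-trans (s≤s (s≤s (s≤s z≤n))) 5≤p) (∣⇒≤ p∣2)

    N∣term : ∀ j i → i < j → N ∣ stirlingTerm m j i
    N∣term (suc j) i (s≤s i≤j) rewrite +-∸-assoc 1 i≤j =
      ∣m⇒∣m*n (s i) (∣n⇒∣m*n ((m ∸ i) C suc (j ∸ i)) (m∣m*n (N ^ (j ∸ i))))

    -- Hence for odd j, N ∣ 2·s(N, N-j), and p^n ∣ s(N, N-j) because p is odd.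
    odd-divisible : ∀ g → suc (2 * g) ≤ N → q ∣ s (suc (2 * g))
    odd-divisible g j≤N = cancel-coprime p-prime p∤2 n (s j) (∣-trans (proj₁ vN) N∣2s)
      where
      j = suc (2 * g)
      N∣2s : N ∣ 2 * s j
      N∣2s = ℤ∣.∣⇒∣ᵤ (subst (+ N ℤ∣.∣_) (sym (twice-stirling1 m g j≤N))
                             (signed-∑-∣ (stirlingTerm m j) j (N∣term j)))

    module _ {h e} (k≤m : suc (2 * h) ≤ m) (vₑ : ValP p (N ∸ suc (2 * h)) e) where
      -- k = 2h+1 and r = N - k.
      k r : ℕ
      k = suc (2 * h)
      r = m ∸ 2 * h

      2h≤m : 2 * h ≤ m
      2h≤m = <⇒≤ k≤m

      -- p^e ∣ D·C(D-1+r, D) for D = d+2, since D·C(D-1+r, D) = r·C(D-1+r, D-1) and p^e ∣ r.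
      absorbed : ∀ d → p ^ e ∣ suc (suc d) * ((suc d + r) C suc (suc d))
      absorbed d = subst (p ^ e ∣_)
        (sym (trans (absorption (suc d + r) (suc d)) (cong (_* ((suc d + r) C suc d)) (m+n∸m≡n (suc d) r))))
        (∣m⇒∣m*n ((suc d + r) C suc d) (proj₁ vₑ))

      -- The modulus p^(e+3n) as p^e·q²·q, matching the three factors in the case D = 2.
      p^[e+3n]≡ : p ^ (e + 3 * n) ≡ p ^ e * q ^ 2 * q
      p^[e+3n]≡ = trans (^-distribˡ-+-* p e (3 * n))
                  (trans (cong (p ^ e *_) (trans (cong (p ^_) (*-comm 3 n)) (sym (^-*-assoc p n 3))))
                         (regroup (p ^ e) q))
        where
        regroup : ∀ a q → a * (q * (q * (q * 1))) ≡ a * (q * (q * 1)) * q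
        regroup = solve-∀

      -- The reflection term of index i = 2h - 1 - d, whose distance to k is D = d + 2,
      -- is divisible by p^(e+3n):
      --   D = 2: p^e ∣ C, N² gives p^(2n), and i is odd so p^n ∣ s i;
      --   D ≥ 3: the p-part of D is absorbed by N^D.
      shape-divisible : ∀ i d → suc d + i ≡ 2 * h →
        p ^ (e + 3 * n) ∣ ((suc d + r) C suc (suc d)) * N ^ suc (suc d) * s i
      shape-divisible i zero split with odd-predecessor {i} {h} split
      ... | g , refl = subst (_∣ ((1 + r) C 2) * N ^ 2 * s i) (sym p^[e+3n]≡)
        (*-pres-∣ (*-pres-∣ (cancel-coprime p-prime p∤2 e ((1 + r) C 2) (absorbed 0)) (^-monoˡ-∣ 2 (proj₁ vN)))
                  (odd-divisible g i≤N))
        where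
        i≤N : i ≤ N
        i≤N = ≤-trans (m≤n+m i 1) (≤-trans (≤-reflexive split) (≤-trans 2h≤m (n≤1+n m)))
      shape-divisible i (suc d) split =
        ∣m⇒∣m*n (s i) (∣-trans (power-absorbs p-prime {e} {n} {suc (suc (suc d))} {B} 5≤p 1≤n (s≤s (s≤s (s≤s z≤n))) (absorbed (suc d)))
                               (*-monoʳ-∣ B (^-monoˡ-∣ (suc (suc (suc d))) (proj₁ vN))))
        where
        B = (suc (suc d) + r) C suc (suc (suc d))

      low-divisible : ∀ i → i < 2 * h → p ^ (e + 3 * n) ∣ stirlingTerm m k i
      low-divisible i i<2h = subst₂ (λ a b → p ^ (e + 3 * n) ∣ (a C b) * N ^ b * s i)
                                    (sym m∸i) (sym k∸i) (shape-divisible i d split)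
        where
        d = 2 * h ∸ suc i
        split : suc d + i ≡ 2 * h
        split = trans (sym (+-suc d i)) (m∸n+n≡m i<2h)
        m∸i : m ∸ i ≡ suc d + r
        m∸i = trans (cong (_∸ i) (sym m≡)) (m+n∸m≡n i (suc d + r))
          where
          rearrange : ∀ i D r → i + (D + r) ≡ D + i + r
          rearrange = solve-∀
          m≡ : i + (suc d + r) ≡ m
          m≡ = trans (rearrange i (suc d) r) (trans (cong (_+ r) split) (m+[n∸m]≡n 2h≤m))
        k∸i : k ∸ i ≡ suc (suc d)
        k∸i = trans (cong (λ x → suc x ∸ i) (sym split)) (m+n∸n≡m (suc (suc d)) i)

      -- The top reflection term is V = (N-k)·N·s(N, N-k+1); all the others are ≡ 0 mod p^(e+3n):
      --   2·s(N, N-k) ≡ V  (mod p^(e+3n)).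
      V : ℕ
      V = r * N * s (2 * h)

      lower : ℤ.ℤ
      lower = ∑[ j < 2 * h ] (sign j ℤ.* + stirlingTerm m k j)

      lower-divisible : + p ^ (e + 3 * n) ℤ∣.∣ lower
      lower-divisible = signed-∑-∣ (stirlingTerm m k) (2 * h) low-divisible

      top-term : sign (2 * h) ℤ.* + stirlingTerm m k (2 * h) ≡ + V
      top-term rewrite sign-even h | m+n∸n≡m 1 (2 * h) | nC1≡n r | *-identityʳ N = ℤ.*-identityˡ (+ V)

      congruence : + (2 * s k) ≡ lower ℤ.+ + V
      congruence = trans (twice-stirling1 m h (≤-trans k≤m (n≤1+n m))) (cong (λ t → lower ℤ.+ t) top-term)

      result : ∀ {e₁ e₀} → ValP p (s (2 * h)) e₁ → ValP p (s k) e₀ →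
        (e₁ ≤ 2 * n ∸ 1 → e₀ ≡ e₁ + e + n) × (2 * n ≤ e₁ → e + 3 * n ≤ e₀)
      result {e₁} {e₀} v₁ v₀ = small , large
        where
        vV : ValP p V (e + n + e₁)
        vV = ValP-* p-prime {x = e + n} {e₁} (ValP-* p-prime {x = e} {n} vₑ vN) v₁

        small : e₁ ≤ 2 * n ∸ 1 → e₀ ≡ e₁ + e + n
        small e₁≤ = trans (ValP-unique p-prime v₀ v2s) (reorder e n e₁)
          where
          v2s : ValP p (s k) (e + n + e₁)
          v2s = ValP-cancel p-prime {w = e + n + e₁} p∤2 (ValP-congruent congruence lower-divisible (below-3n e 1≤n e₁≤) vV)
          reorder : ∀ e n e₁ → e + n + e₁ ≡ e₁ + e + n
          reorder = solve-∀

        large : 2 * n ≤ e₁ → e + 3 * n ≤ e₀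
        large 2n≤e₁ = ValP-bound p-prime v₀ (cancel-coprime p-prime p∤2 (e + 3 * n) (s k)
                        (∣-congruent congruence lower-divisible (∣-trans (^-monoʳ-∣ p (above-3n e n 2n≤e₁)) (proj₁ vV))))

  stirling1-odd-valuation : ∀ {p n h e₁ e₀ e} → Prime p → 5 ≤ p → 1 ≤ n → ∀ N → ValP p N n →
    suc (2 * h) ≤ N ∸ 1 →
    ValP p (stirling1 N (N ∸ suc (2 * h) + 1)) e₁ →
    ValP p (stirling1 N (N ∸ suc (2 * h))) e₀ →
    ValP p (N ∸ suc (2 * h)) e →
    (e₁ ≤ 2 * n ∸ 1 → e₀ ≡ e₁ + e + n) × (2 * n ≤ e₁ → e + 3 * n ≤ e₀)
  stirling1-odd-valuation p-prime 5≤p 1≤n zero    _  () v₁ v₀ vₑ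
  stirling1-odd-valuation {p} {h = h} {e₁} p-prime 5≤p 1≤n (suc m) vN k≤m v₁ v₀ vₑ =
    result p-prime 5≤p 1≤n vN {h} k≤m vₑ (subst (λ j → ValP p (stirling1 (suc m) j) e₁) shift v₁) v₀
    where
    shift : m ∸ 2 * h + 1 ≡ suc m ∸ 2 * h
    shift = trans (+-comm (m ∸ 2 * h) 1) (sym (+-∸-assoc 1 (<⇒≤ k≤m)))


open import Defs
open import Data.Nat using (ℕ; _+_; _*_; _∸_; _^_; _≤_)
open import Data.Nat.Primality using (Prime)
open import Data.Nat.GCD using (gcd)
open import Data.Nat.Divisibility using (_∣_)
open import Data.Product using (_×_; _,_)
open import Relation.Nullary using (¬_)
open import Relation.Binary.PropositionalEquality using (_≡_; refl)
open Valuation using (ValP-unit-multiple; gcd≡1⇒∤)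
open OddStirlingValuation using (odd-form; stirling1-odd-valuation)

theorem1p3 : (p a n k : ℕ) → Prime p → 5 ≤ p → 1 ≤ a → 1 ≤ n → gcd a p ≡ 1 →
    ¬ (2 ∣ k) → 1 ≤ k → k ≤ a * p ^ n ∸ 1 →
    (e₁ e₀ e : ℕ) →
    ValP p (stirling1 (a * p ^ n) (a * p ^ n ∸ k + 1)) e₁ →
    ValP p (stirling1 (a * p ^ n) (a * p ^ n ∸ k)) e₀ →
    ValP p (a * p ^ n ∸ k) e →
    (e₁ ≤ 2 * n ∸ 1 → e₀ ≡ e₁ + e + n) × (2 * n ≤ e₁ → e + 3 * n ≤ e₀)
theorem1p3 p a n k p-prime 5≤p _ 1≤n gcd≡1 2∤k _ k≤ e₁ e₀ e v₁ v₀ vₑ with odd-form k 2∤k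
... | h , refl = stirling1-odd-valuation {h = h} p-prime 5≤p 1≤n (a * p ^ n)
                   (ValP-unit-multiple p-prime {a} n (gcd≡1⇒∤ p-prime gcd≡1)) k≤ v₁ v₀ vₑ
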